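{- Let $N=(P,T,\mathrm{pre},\mathrm{cont},\mathrm{post},M_0)$ be a safe, loop-free Read Petri net. For any markings $M,M'\subseteq P$: $M'$ is reachable from $M$ in zero or more steps of the atomic semantics of $N$ if and only if $\beta(M')$ is reachable from $\beta(M)$ in zero or more steps of the asynchronous updating of the Boolean network $\beta(N)$.
   Context: An RPN has finite places $P$, transitions $T$, each $t$ with nonempty preset ${}^\bullet t$, context $\underline t\subseteq P\setminus{}^\bullet t$ disjoint from the postset $t^\bullet$. $t$ is enabled in $M\subseteq P$ if ${}^\bullet t\cup\underline t\subseteq M$; firing gives $(M\setminus{}^\bullet t)\cup t^\bullet$ (atomic semantics). Safe: whenever $t$ is enabled in a reachable marking $M$, $(M\setminus{}^\bullet t)\cap t^\bullet=\emptyset$. Loop-free: ${}^\bullet t\cap t^\bullet=\emptyset$ for all $t$. For a place $p$, ${}^\bullet p$ is the set of transitions having $p$ in their postset and $p^\bullet$ the set of transitions having $p$ in their preset. Identify $P\cup T$ with $\{1,\dots,|P|+|T|\}$. $\beta(N)$ is the Boolean network of dimension $|P|+|T|$ with $\beta(N)_p(x)=\big(\bigvee_{t\in{}^\bullet p}x_t\big)\vee\big(x_p\wedge\bigwedge_{t\in p^\bullet}\neg x_t\big)$ for $p\in P$, and $\beta(N)_t(x)=\big(\bigwedge_{p\in{}^\bullet t\cup\underline t}x_p\wedge\bigwedge_{t'\in T}\neg x_{t'}\big)\vee\big(x_t\wedge(\bigvee_{p\in t^\bullet}\neg x_p\vee\bigvee_{p\in{}^\bullet t}x_p)\big)$ for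 $t\in T$ (empty conjunction $=1$, empty disjunction $=0$). For a marking $M$, $\beta(M)$ is the configuration with $\beta(M)_p=1$ iff $p\in M$ for $p\in P$, and $\beta(M)_t=0$ for $t\in T$. Asynchronous updating of a BN $g$: $x\to y$ iff exactly one component $i$ differs and $y_i=g_i(x)$. -}

module Defs where

open import Data.Nat using (ℕ; _+_)
open import Data.Fin using (Fin; _↑ˡ_; _↑ʳ_)
open import Data.Fin.Subset using (Subset; _⊆_; _∩_; _∪_; _─_; Nonempty; Empty)
open import Data.Bool using (Bool; true; false; _∧_; _∨_; not)
open import Data.Vec using (Vec; lookup; tabulate; replicate; _++_)
open import Data.List using (List; map; allFin)
open import Data.Bool.ListAction using (and; or)
open import Data.Product using (Σ; _×_; ∃)
open import Relation.Binary.PropositionalEquality using (_≡_; _≢_)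
open import Relation.Binary.Construct.Closure.ReflexiveTransitive using (Star)

record RPN : Set where
  field
    np nt : ℕ
    pre cont post : Fin nt → Subset np
    M0 : Subset np
    pre-nonempty : ∀ t → Nonempty (pre t)
    cont-pre-disjoint : ∀ t → Empty (cont t ∩ pre t)
    cont-post-disjoint : ∀ t → Empty (cont t ∩ post t)

Marking : RPN → Set
Marking N = Subset (RPN.np N)

module _ (N : RPN) where
  open RPN N

  Enabled : Fin nt → Subset np → Set
  Enabled t M = (pre t ∪ cont t) ⊆ M

  fire : Fin nt → Subset np → Subset np
  fire t M = (M ─ pre t) ∪ post t

  Step : Subset np → Subset np → Set
  Step M M' = Σ (Fin nt) λ t → Enabled t M × M' ≡ fire t M

  Safe : Set
  Safe = ∀ (M : Subset np) (t : Fin nt) → Star Step M0 M → Enabled t M →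
           Empty ((M ─ pre t) ∩ post t)

  LoopFree : Set
  LoopFree = ∀ t → Empty (pre t ∩ post t)

BN : ℕ → Set
BN n = Vec Bool n → Vec Bool n

AsyncStep : ∀ {n} → BN n → Vec Bool n → Vec Bool n → Set
AsyncStep {n} g x y =
  ∃ λ (i : Fin n) → lookup x i ≢ lookup y i × lookup y i ≡ lookup (g x) i ×
    (∀ (j : Fin n) → j ≢ i → lookup y j ≡ lookup x j)

-- places are the components p ↑ˡ nt, transitions the components np ↑ʳ t
module _ (N : RPN) where
  open RPN N

  β : BN (np + nt)
  β x = tabulate fP ++ tabulate fT
    where
    xP : Fin np → Bool
    xP p = lookup x (p ↑ˡ nt)
    xT : Fin nt → Bool
    xT t = lookup x (np ↑ʳ t)
    fP : Fin np → Bool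
    fP p = or (map (λ t → lookup (post t) p ∧ xT t) (allFin nt))
           ∨ (xP p ∧ and (map (λ t → not (lookup (pre t) p) ∨ not (xT t)) (allFin nt)))
    fT : Fin nt → Bool
    fT t = (and (map (λ p → not (lookup (pre t) p ∨ lookup (cont t) p) ∨ xP p) (allFin np))
             ∧ and (map (λ t' → not (xT t')) (allFin nt)))
           ∨ (xT t ∧ (or (map (λ p → lookup (post t) p ∧ not (xP p)) (allFin np))
                      ∨ or (map (λ p → lookup (pre t) p ∧ xP p) (allFin np))))

  βM : Subset np → Vec Bool (np + nt)
  βM M = M ++ replicate nt false

module Submission where

-- The encoding β(N) simulates one firing M →ₜ fire t M of the net by a run of
-- three phases of the Boolean network:
--   * switch the transition component t on (its guard holds exactly when t is
--     enabled and no transition is on);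
--   * update the place components one by one, each to its value in fire t M;
--   * switch t off again, which β(N) allows once every place has its new value.
-- Conversely, every asynchronous run between encodings of markings passes only
-- through configurations that are either Idle (no transition on, the places
-- encode a marking) or Busy (exactly one enabled transition t on, every place
-- holding its value before or after firing t); a Busy phase can only end in
-- the Idle encoding of fire t M.  So the run projects to a firing sequence.
--
-- The
-- theorem combines the two.

open import Defs
open import Function.Base using (_∘_)
open import Function.Bundles using (_⇔_; mk⇔)
open import Relation.Binary.Construct.Closure.ReflexiveTransitive using (Star; ε; _◅_; _◅◅_)
open import Data.Nat.Base using (ℕ; _+_)
open import Data.Fin.Base using (Fin; zero; suc; _↑ˡ_; _↑ʳ_; splitAt)
open import Data.Fin.Properties using (↑ˡ-injective; ↑ʳ-injective; splitAt-↑ˡ; splitAt-↑ʳ; splitAt⁻¹-↑ˡ; splitAt⁻¹-↑ʳ; _≟_)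
open import Data.Fin.Subset using (Subset; _⊆_; _∪_; _─_)
open import Data.Bool.Base using (Bool; true; false; _∧_; _∨_; not)
open import Data.Bool.Properties using (∧-zeroʳ; ∨-zeroʳ; ∧-identityʳ; ∨-identityʳ; ∨-comm; ∧-conicalˡ; ∧-conicalʳ; ∨-conicalˡ; ∨-conicalʳ; ¬-not) renaming (_≟_ to _≟ᵇ_)
open import Data.Vec.Base using (Vec; _∷_; lookup; tabulate; replicate; _[_]≔_)
open import Data.Vec.Properties using (lookup-++ˡ; lookup-++ʳ; lookup∘tabulate; lookup-replicate; lookup-zipWith; lookup∘update; lookup∘update′; []≔-lookup; []=⇒lookup; lookup⇒[]=)
open import Data.Vec.Relation.Binary.Pointwise.Extensional using (ext; Pointwise-≡⇒≡)
open import Data.List.Base using (List; []; _∷_; map; allFin)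
open import Data.List.Membership.Propositional using (_∈_)
open import Data.List.Membership.Propositional.Properties using (∈-allFin)
open import Data.List.Relation.Unary.Any using (here; there)
open import Data.Bool.ListAction using (and; or)
open import Data.Product.Base using (∃; _×_; _,_; proj₁; proj₂)
open import Data.Sum.Base using (_⊎_; inj₁; inj₂)
open import Data.Empty using (⊥-elim)
open import Relation.Nullary using (yes; no)
open import Relation.Binary.PropositionalEquality
  using (_≡_; _≢_; refl; sym; trans; cong; cong₂; subst; module ≡-Reasoning)

module _ {A : Set} (f : A → Bool) where

  or-false : ∀ l → (∀ {x} → x ∈ l → f x ≡ false) → or (map f l) ≡ false
  or-false []      _ = refl
  or-false (x ∷ l) h = cong₂ _∨_ (h (here refl)) (or-false l (h ∘ there))

  or-false⁻ : ∀ l → or (map f l) ≡ false → ∀ {x} → x ∈ l → f x ≡ false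
  or-false⁻ (y ∷ l) e (here refl) = ∨-conicalˡ (f y) _ e
  or-false⁻ (y ∷ l) e (there x∈l) = or-false⁻ l (∨-conicalʳ (f y) _ e) x∈l

  or-true : ∀ {x l} → x ∈ l → f x ≡ true → or (map f l) ≡ true
  or-true {l = _ ∷ l} (here refl) e = cong (_∨ or (map f l)) e
  or-true {l = y ∷ l} (there x∈l) e = trans (cong (f y ∨_) (or-true x∈l e)) (∨-zeroʳ (f y))

  and-true : ∀ l → (∀ {x} → x ∈ l → f x ≡ true) → and (map f l) ≡ true
  and-true []      _ = refl
  and-true (x ∷ l) h = cong₂ _∧_ (h (here refl)) (and-true l (h ∘ there))

  and-true⁻ : ∀ l → and (map f l) ≡ true → ∀ {x} → x ∈ l → f x ≡ true
  and-true⁻ (y ∷ l) e (here refl) = ∧-conicalˡ (f y) _ e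
  and-true⁻ (y ∷ l) e (there x∈l) = and-true⁻ l (∧-conicalʳ (f y) _ e) x∈l

  and-false : ∀ {x l} → x ∈ l → f x ≡ false → and (map f l) ≡ false
  and-false {l = _ ∷ l} (here refl) e = cong (_∧ and (map f l)) e
  and-false {l = y ∷ l} (there x∈l) e = trans (cong (f y ∧_) (and-false x∈l e)) (∧-zeroʳ (f y))

⋁ ⋀ : ∀ {n} → (Fin n → Bool) → Bool
⋁ f = or (map f (allFin _))
⋀ f = and (map f (allFin _))

module _ {n} {f : Fin n → Bool} where

  ⋁-false : (∀ i → f i ≡ false) → ⋁ f ≡ false
  ⋁-false h = or-false f (allFin _) (λ {i} _ → h i)

  ⋁-false⁻ : ⋁ f ≡ false → ∀ i → f i ≡ false
  ⋁-false⁻ e i = or-false⁻ f (allFin _) e (∈-allFin i)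

  ⋀-true : (∀ i → f i ≡ true) → ⋀ f ≡ true
  ⋀-true h = and-true f (allFin _) (λ {i} _ → h i)

  ⋀-true⁻ : ⋀ f ≡ true → ∀ i → f i ≡ true
  ⋀-true⁻ e i = and-true⁻ f (allFin _) e (∈-allFin i)

  ⋀-false : ∀ i → f i ≡ false → ⋀ f ≡ false
  ⋀-false i = and-false f (∈-allFin i)

  ⋁-single : ∀ i → (∀ j → j ≢ i → f j ≡ false) → ⋁ f ≡ f i
  ⋁-single i h with f i in fi
  ... | true  = or-true f (∈-allFin i) fi
  ... | false = ⋁-false others
    where
    others : ∀ j → f j ≡ false
    others j with j ≟ i
    ... | yes refl = fi
    ... | no j≢i   = h j j≢i

  ⋀-single : ∀ i → (∀ j → j ≢ i → f j ≡ true) → ⋀ f ≡ f i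
  ⋀-single i h with f i in fi
  ... | false = ⋀-false i fi
  ... | true  = ⋀-true others
    where
    others : ∀ j → f j ≡ true
    others j with j ≟ i
    ... | yes refl = fi
    ... | no j≢i   = h j j≢i

implication : ∀ a b → (a ≡ true → b ≡ true) → not a ∨ b ≡ true
implication false b _ = refl
implication true  b h = h refl

implication⁻ : ∀ a b → not a ∨ b ≡ true → a ≡ true → b ≡ true
implication⁻ true b e refl = e

-- A single place during the firing of a transition: m is its old value,
-- a its membership in the preset, c in the postset, f = (m ∧ ¬a) ∨ c its new
-- value, and x the current value (old or new).

-- The place rule of β(N) while the transition is on, c ∨ (x ∧ ¬a), yields f.
update-reaches-fire : ∀ {x m a c f} → f ≡ (m ∧ not a) ∨ c → x ≡ m ⊎ x ≡ f → c ∨ (x ∧ not a) ≡ f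
update-reaches-fire {x} {c = c} refl (inj₁ refl) = ∨-comm c (x ∧ not _)
update-reaches-fire {m = m} {a} {c} refl (inj₂ refl) = idempotent m a c
  where
  idempotent : ∀ m a c → c ∨ (((m ∧ not a) ∨ c) ∧ not a) ≡ (m ∧ not a) ∨ c
  idempotent false false false = refl
  idempotent false false true  = refl
  idempotent false true  false = refl
  idempotent false true  true  = refl
  idempotent true  false false = refl
  idempotent true  false true  = refl
  idempotent true  true  false = refl
  idempotent true  true  true  = refl

-- The release condition of β(N) (c → x and a → ¬x) forces the new value.
settled-is-fire : ∀ {x m a c f} → f ≡ (m ∧ not a) ∨ c → x ≡ m ⊎ x ≡ f →
                  c ∧ not x ≡ false → a ∧ x ≡ false → x ≡ f
settled-is-fire refl (inj₂ refl) _ _ = refl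
settled-is-fire {x} {a = a} {c} refl (inj₁ refl) = stable x a c
  where
  stable : ∀ x a c → c ∧ not x ≡ false → a ∧ x ≡ false → x ≡ (x ∧ not a) ∨ c
  stable false _     false _ _ = refl
  stable true  false _     _ _ = refl
  stable false _     true  () _
  stable true  true  _     _ ()

-- Conversely, for a loop-free transition the new value meets the release condition.
fire-is-settled : ∀ {m a c f} → f ≡ (m ∧ not a) ∨ c → (a ≡ true → c ≡ false) →
                  c ∧ not f ≡ false × a ∧ f ≡ false
fire-is-settled {m} {a} {c} refl no-loop = settled m a c no-loop
  where
  settled : ∀ m a c → (a ≡ true → c ≡ false) → c ∧ not ((m ∧ not a) ∨ c) ≡ false × a ∧ ((m ∧ not a) ∨ c) ≡ false
  settled m     false false _  = refl , refl
  settled false false true  _  = refl , refl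
  settled true  false true  _  = refl , refl
  settled m     true  c     lf with lf refl
  settled false true  .false _ | refl = refl , refl
  settled true  true  .false _ | refl = refl , refl

data Split (m n : ℕ) : Fin (m + n) → Set where
  left  : (i : Fin m) → Split m n (i ↑ˡ n)
  right : (j : Fin n) → Split m n (m ↑ʳ j)

split : ∀ m n (k : Fin (m + n)) → Split m n k
split m n k with splitAt m k in eq
... | inj₁ i = subst (Split m n) (splitAt⁻¹-↑ˡ eq) (left i)
... | inj₂ j = subst (Split m n) (splitAt⁻¹-↑ʳ eq) (right j)

↑ˡ≢↑ʳ : ∀ {m n} (i : Fin m) (j : Fin n) → i ↑ˡ n ≢ m ↑ʳ j
↑ˡ≢↑ʳ {m} {n} i j e with trans (sym (splitAt-↑ˡ m i n)) (trans (cong (splitAt m) e) (splitAt-↑ʳ m n j))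
... | ()

lookup-fire : ∀ {n} (M Q R : Subset n) p → lookup ((M ─ Q) ∪ R) p ≡ (lookup M p ∧ not (lookup Q p)) ∨ lookup R p
lookup-fire (false ∷ M) (false ∷ Q) (r ∷ R) zero = refl
lookup-fire (false ∷ M) (true  ∷ Q) (r ∷ R) zero = refl
lookup-fire (true  ∷ M) (false ∷ Q) (r ∷ R) zero = refl
lookup-fire (true  ∷ M) (true  ∷ Q) (r ∷ R) zero = refl
lookup-fire (_ ∷ M) (_ ∷ Q) (_ ∷ R) (suc p) = lookup-fire M Q R p

⊆⇒lookup : ∀ {n} {S M : Subset n} → S ⊆ M → ∀ p → lookup S p ≡ true → lookup M p ≡ true
⊆⇒lookup S⊆M p e = []=⇒lookup (S⊆M (lookup⇒[]= p _ e))

lookup⇒⊆ : ∀ {n} {S M : Subset n} → (∀ p → lookup S p ≡ true → lookup M p ≡ true) → S ⊆ M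
lookup⇒⊆ h {p} p∈S = lookup⇒[]= p _ (h p ([]=⇒lookup p∈S))

Except : ∀ {n} → Fin n → Vec Bool n → Vec Bool n → Set
Except i z z' = ∀ j → j ≢ i → lookup z' j ≡ lookup z j

update-except : ∀ {n} (z : Vec Bool n) i v → Except i z (z [ i ]≔ v)
update-except z i v j j≢i = lookup∘update′ j≢i z v

async-set : ∀ {n} (g : BN n) z i {v} → lookup (g z) i ≡ v → Star (AsyncStep g) z (z [ i ]≔ v)
async-set g z i {v} gv with lookup z i ≟ᵇ v
... | yes same = subst (Star (AsyncStep g) z) unchanged ε
  where
  unchanged : z ≡ z [ i ]≔ v
  unchanged = sym (trans (cong (z [ i ]≔_) (sym same)) ([]≔-lookup z i))
... | no differ = (i , changed , trans (lookup∘update i z v) (sym gv) , update-except z i v) ◅ ε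
  where
  changed : lookup z i ≢ lookup (z [ i ]≔ v) i
  changed e = differ (trans e (lookup∘update i z v))

module Simulation (N : RPN) (loop-free : LoopFree N) where
  open RPN N

  Config : Set
  Config = Vec Bool (np + nt)

  AS : Config → Config → Set
  AS = AsyncStep (β N)

  xP : Config → Fin np → Bool
  xP z p = lookup z (p ↑ˡ nt)

  xT : Config → Fin nt → Bool
  xT z t = lookup z (np ↑ʳ t)

  no-self-loop : ∀ t p → lookup (pre t) p ≡ true → lookup (post t) p ≡ false
  no-self-loop t p pre-p with lookup (post t) p in post-p
  ... | false = refl
  ... | true  = ⊥-elim (loop-free t (p , lookup⇒[]= p _ (trans (lookup-zipWith _∧_ p (pre t) (post t)) (cong₂ _∧_ pre-p post-p))))

  Guard : Fin nt → Config → Bool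
  Guard t z = ⋀ (λ p → not (lookup (pre t) p ∨ lookup (cont t) p) ∨ xP z p)

  Pending : Fin nt → Config → Bool
  Pending t z = ⋁ (λ p → lookup (post t) p ∧ not (xP z p)) ∨ ⋁ (λ p → lookup (pre t) p ∧ xP z p)

  β-place : ∀ z p → lookup (β N z) (p ↑ˡ nt) ≡
    ⋁ (λ t → lookup (post t) p ∧ xT z t) ∨ (xP z p ∧ ⋀ (λ t → not (lookup (pre t) p) ∨ not (xT z t)))
  β-place z p = trans (lookup-++ˡ (tabulate _) (tabulate _) p) (lookup∘tabulate _ p)

  β-transition : ∀ z t → lookup (β N z) (np ↑ʳ t) ≡ (Guard t z ∧ ⋀ (λ t' → not (xT z t'))) ∨ (xT z t ∧ Pending t z)
  β-transition z t = trans (lookup-++ʳ {m = np} (tabulate _) (tabulate _) t) (lookup∘tabulate _ t)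

  Quiet : Config → Set
  Quiet z = ∀ t → xT z t ≡ false

  record Firing (t : Fin nt) (z : Config) : Set where
    field
      on  : xT z t ≡ true
      off : ∀ t' → t' ≢ t → xT z t' ≡ false

  β-place-quiet : ∀ z → Quiet z → ∀ p → lookup (β N z) (p ↑ˡ nt) ≡ xP z p
  β-place-quiet z quiet p = begin
      lookup (β N z) (p ↑ˡ nt)
    ≡⟨ β-place z p ⟩
      ⋁ (λ t → lookup (post t) p ∧ xT z t) ∨ (xP z p ∧ ⋀ (λ t → not (lookup (pre t) p) ∨ not (xT z t)))
    ≡⟨ cong₂ (λ u v → u ∨ (xP z p ∧ v)) (⋁-false nothing-produces) (⋀-true nothing-consumes) ⟩
      xP z p ∧ true
    ≡⟨ ∧-identityʳ _ ⟩
      xP z p ∎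
    where
    open ≡-Reasoning
    nothing-produces : ∀ t → lookup (post t) p ∧ xT z t ≡ false
    nothing-produces t = trans (cong (lookup (post t) p ∧_) (quiet t)) (∧-zeroʳ _)
    nothing-consumes : ∀ t → not (lookup (pre t) p) ∨ not (xT z t) ≡ true
    nothing-consumes t = trans (cong (λ b → not (lookup (pre t) p) ∨ not b) (quiet t)) (∨-zeroʳ _)

  β-transition-quiet : ∀ z → Quiet z → ∀ t → lookup (β N z) (np ↑ʳ t) ≡ Guard t z
  β-transition-quiet z quiet t = begin
      lookup (β N z) (np ↑ʳ t)
    ≡⟨ β-transition z t ⟩
      (Guard t z ∧ ⋀ (λ t' → not (xT z t'))) ∨ (xT z t ∧ Pending t z)
    ≡⟨ cong₂ (λ u v → (Guard t z ∧ u) ∨ (v ∧ Pending t z)) (⋀-true (cong not ∘ quiet)) (quiet t) ⟩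
      (Guard t z ∧ true) ∨ false
    ≡⟨ trans (∨-identityʳ _) (∧-identityʳ _) ⟩
      Guard t z ∎
    where open ≡-Reasoning

  β-place-firing : ∀ {t z} → Firing t z → ∀ p →
    lookup (β N z) (p ↑ˡ nt) ≡ lookup (post t) p ∨ (xP z p ∧ not (lookup (pre t) p))
  β-place-firing {t} {z} firing p = begin
      lookup (β N z) (p ↑ˡ nt)
    ≡⟨ β-place z p ⟩
      ⋁ (λ t' → lookup (post t') p ∧ xT z t') ∨ (xP z p ∧ ⋀ (λ t' → not (lookup (pre t') p) ∨ not (xT z t')))
    ≡⟨ cong₂ (λ u v → u ∨ (xP z p ∧ v)) (⋁-single t produced-by-others) (⋀-single t consumed-by-others) ⟩
      (lookup (post t) p ∧ xT z t) ∨ (xP z p ∧ (not (lookup (pre t) p) ∨ not (xT z t)))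
    ≡⟨ cong (λ b → (lookup (post t) p ∧ b) ∨ (xP z p ∧ (not (lookup (pre t) p) ∨ not b))) (Firing.on firing) ⟩
      (lookup (post t) p ∧ true) ∨ (xP z p ∧ (not (lookup (pre t) p) ∨ false))
    ≡⟨ cong₂ (λ u v → u ∨ (xP z p ∧ v)) (∧-identityʳ _) (∨-identityʳ _) ⟩
      lookup (post t) p ∨ (xP z p ∧ not (lookup (pre t) p)) ∎
    where
    open ≡-Reasoning
    produced-by-others : ∀ t' → t' ≢ t → lookup (post t') p ∧ xT z t' ≡ false
    produced-by-others t' t'≢t = trans (cong (lookup (post t') p ∧_) (Firing.off firing t' t'≢t)) (∧-zeroʳ _)
    consumed-by-others : ∀ t' → t' ≢ t → not (lookup (pre t') p) ∨ not (xT z t') ≡ true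
    consumed-by-others t' t'≢t = trans (cong (λ b → not (lookup (pre t') p) ∨ not b) (Firing.off firing t' t'≢t)) (∨-zeroʳ _)

  β-transition-firing-other : ∀ {t z} → Firing t z → ∀ {t'} → t' ≢ t → lookup (β N z) (np ↑ʳ t') ≡ false
  β-transition-firing-other {t} {z} firing {t'} t'≢t = begin
      lookup (β N z) (np ↑ʳ t')
    ≡⟨ β-transition z t' ⟩
      (Guard t' z ∧ ⋀ (λ s → not (xT z s))) ∨ (xT z t' ∧ Pending t' z)
    ≡⟨ cong₂ (λ u v → (Guard t' z ∧ u) ∨ (v ∧ Pending t' z))
             (⋀-false t (cong not (Firing.on firing))) (Firing.off firing t' t'≢t) ⟩
      (Guard t' z ∧ false) ∨ false
    ≡⟨ trans (∨-identityʳ _) (∧-zeroʳ _) ⟩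
      false ∎
    where open ≡-Reasoning

  β-transition-firing-self : ∀ {t z} → Firing t z → lookup (β N z) (np ↑ʳ t) ≡ Pending t z
  β-transition-firing-self {t} {z} firing = begin
      lookup (β N z) (np ↑ʳ t)
    ≡⟨ β-transition z t ⟩
      (Guard t z ∧ ⋀ (λ s → not (xT z s))) ∨ (xT z t ∧ Pending t z)
    ≡⟨ cong₂ (λ u v → (Guard t z ∧ u) ∨ (v ∧ Pending t z))
             (⋀-false t (cong not (Firing.on firing))) (Firing.on firing) ⟩
      (Guard t z ∧ false) ∨ Pending t z
    ≡⟨ cong (_∨ Pending t z) (∧-zeroʳ (Guard t z)) ⟩
      Pending t z ∎
    where open ≡-Reasoning

  record Idle (M : Marking N) (z : Config) : Set where
    field
      places : ∀ p → xP z p ≡ lookup M p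
      quiet  : Quiet z

  record Busy (M : Marking N) (t : Fin nt) (z : Config) : Set where
    field
      enabled : Enabled N t M
      midway  : ∀ p → xP z p ≡ lookup M p ⊎ xP z p ≡ lookup (fire N t M) p
      firing  : Firing t z

  Settled : Marking N → Fin nt → Config → Set
  Settled M t z = ∀ p → xP z p ≡ lookup (fire N t M) p

  idle-βM : ∀ M → Idle M (βM N M)
  idle-βM M = record
    { places = lookup-++ˡ M (replicate nt false)
    ; quiet  = λ t → trans (lookup-++ʳ M (replicate nt false) t) (lookup-replicate t false)
    }

  idle⇒βM : ∀ {M z} → Idle M z → z ≡ βM N M
  idle⇒βM {M} {z} idle = Pointwise-≡⇒≡ (ext agree)
    where
    agree : ∀ i → lookup z i ≡ lookup (βM N M) i
    agree i with split np nt i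
    ... | left p  = trans (Idle.places idle p) (sym (Idle.places (idle-βM M) p))
    ... | right t = trans (Idle.quiet idle t) (sym (Idle.quiet (idle-βM M) t))

  idle-unique : ∀ {M M' z} → Idle M z → Idle M' z → M ≡ M'
  idle-unique idle idle' = Pointwise-≡⇒≡ (ext λ p → trans (sym (Idle.places idle p)) (Idle.places idle' p))

  pre-or-cont : ∀ t p → lookup (pre t ∪ cont t) p ≡ lookup (pre t) p ∨ lookup (cont t) p
  pre-or-cont t p = lookup-zipWith _∨_ p (pre t) (cont t)

  enabled⇒guard : ∀ {t M z} → Idle M z → Enabled N t M → Guard t z ≡ true
  enabled⇒guard {t} idle en = ⋀-true λ p → implication _ _ λ used →
    trans (Idle.places idle p) (⊆⇒lookup en p (trans (pre-or-cont t p) used))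

  guard⇒enabled : ∀ t {M z} → Idle M z → Guard t z ≡ true → Enabled N t M
  guard⇒enabled t idle guard = lookup⇒⊆ λ p used →
    trans (sym (Idle.places idle p)) (implication⁻ _ _ (⋀-true⁻ guard p) (trans (sym (pre-or-cont t p)) used))

  β-place-busy : ∀ {M t z} → Busy M t z → ∀ p → lookup (β N z) (p ↑ˡ nt) ≡ lookup (fire N t M) p
  β-place-busy {M} {t} busy p =
    trans (β-place-firing (Busy.firing busy) p)
          (update-reaches-fire (lookup-fire M (pre t) (post t) p) (Busy.midway busy p))

  settled⇒released : ∀ {M t z} → Busy M t z → Settled M t z → lookup (β N z) (np ↑ʳ t) ≡ false
  settled⇒released {M} {t} {z} busy settled =
    trans (β-transition-firing-self (Busy.firing busy)) (cong₂ _∨_ (⋁-false postset-marked) (⋁-false preset-unmarked))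
    where
    new-value-settled : ∀ p → lookup (post t) p ∧ not (lookup (fire N t M) p) ≡ false
                              × lookup (pre t) p ∧ lookup (fire N t M) p ≡ false
    new-value-settled p = fire-is-settled (lookup-fire M (pre t) (post t) p) (no-self-loop t p)
    postset-marked : ∀ p → lookup (post t) p ∧ not (xP z p) ≡ false
    postset-marked p = trans (cong (λ x → lookup (post t) p ∧ not x) (settled p)) (proj₁ (new-value-settled p))
    preset-unmarked : ∀ p → lookup (pre t) p ∧ xP z p ≡ false
    preset-unmarked p = trans (cong (lookup (pre t) p ∧_) (settled p)) (proj₂ (new-value-settled p))

  released⇒settled : ∀ {M t z} → Busy M t z → lookup (β N z) (np ↑ʳ t) ≡ false → Settled M t z
  released⇒settled {M} {t} {z} busy released p =
    settled-is-fire (lookup-fire M (pre t) (post t) p) (Busy.midway busy p)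
      (⋁-false⁻ (∨-conicalˡ (⋁ postset-unmarked) _ not-pending) p) (⋁-false⁻ (∨-conicalʳ (⋁ postset-unmarked) _ not-pending) p)
    where
    postset-unmarked : Fin np → Bool
    postset-unmarked q = lookup (post t) q ∧ not (xP z q)
    not-pending : Pending t z ≡ false
    not-pending = trans (sym (β-transition-firing-self (Busy.firing busy))) released

  idle→busy : ∀ {M t z z'} → Idle M z → Enabled N t M → Except (np ↑ʳ t) z z' → xT z' t ≡ true → Busy M t z'
  idle→busy {t = t} idle en except on = record
    { enabled = en
    ; midway  = λ p → inj₁ (trans (except (p ↑ˡ nt) (↑ˡ≢↑ʳ p t)) (Idle.places idle p))
    ; firing  = record
      { on  = on
      ; off = λ t' t'≢t → trans (except (np ↑ʳ t') (t'≢t ∘ ↑ʳ-injective np t' t)) (Idle.quiet idle t')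
      }
    }

  busy→busy : ∀ {M t z z'} p → Busy M t z → Except (p ↑ˡ nt) z z' → xP z' p ≡ lookup (fire N t M) p → Busy M t z'
  busy→busy {M} {t} {z} {z'} p busy except new = record
    { enabled = Busy.enabled busy
    ; midway  = midway
    ; firing  = record
      { on  = trans (except (np ↑ʳ t) (↑ˡ≢↑ʳ p t ∘ sym)) (Firing.on (Busy.firing busy))
      ; off = λ t' t'≢t → trans (except (np ↑ʳ t') (↑ˡ≢↑ʳ p t' ∘ sym)) (Firing.off (Busy.firing busy) t' t'≢t)
      }
    }
    where
    midway : ∀ q → xP z' q ≡ lookup M q ⊎ xP z' q ≡ lookup (fire N t M) q
    midway q with q ≟ p
    ... | yes refl = inj₂ new
    ... | no q≢p with except (q ↑ˡ nt) (q≢p ∘ ↑ˡ-injective nt q p) | Busy.midway busy q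
    ...   | same | inj₁ old   = inj₁ (trans same old)
    ...   | same | inj₂ fired = inj₂ (trans same fired)

  busy→idle : ∀ {M t z z'} → Busy M t z → Settled M t z → Except (np ↑ʳ t) z z' → xT z' t ≡ false → Idle (fire N t M) z'
  busy→idle {t = t} {z' = z'} busy settled except off = record
    { places = λ p → trans (except (p ↑ˡ nt) (↑ˡ≢↑ʳ p t)) (settled p)
    ; quiet  = quiet
    }
    where
    quiet : Quiet z'
    quiet t' with t' ≟ t
    ... | yes refl = off
    ... | no t'≢t  = trans (except (np ↑ʳ t') (t'≢t ∘ ↑ʳ-injective np t' t)) (Firing.off (Busy.firing busy) t' t'≢t)

  start : ∀ {M t} → Enabled N t M → Star AS (βM N M) (βM N M [ np ↑ʳ t ]≔ true)
  start {M} {t} en = async-set (β N) (βM N M) (np ↑ʳ t)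
    (trans (β-transition-quiet (βM N M) (Idle.quiet (idle-βM M)) t) (enabled⇒guard (idle-βM M) en))

  started : ∀ {M t} → Enabled N t M → Busy M t (βM N M [ np ↑ʳ t ]≔ true)
  started {M} {t} en = idle→busy (idle-βM M) en (update-except (βM N M) (np ↑ʳ t) true) (lookup∘update (np ↑ʳ t) (βM N M) true)

  settle : ∀ {M t z} (l : List (Fin np)) → Busy M t z →
    ∃ λ z' → Star AS z z' × Busy M t z' × (∀ {p} → p ∈ l → xP z' p ≡ lookup (fire N t M) p)
  settle {z = z} [] busy = z , ε , busy , λ ()
  settle {M} {t} (q ∷ l) busy with settle l busy
  ... | z₁ , run , busy₁ , done = z₂ , run ◅◅ async-set (β N) z₁ (q ↑ˡ nt) (β-place-busy busy₁ q)
                                    , busy→busy q busy₁ (update-except z₁ (q ↑ˡ nt) _) q-new , done'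
    where
    z₂ : Config
    z₂ = z₁ [ q ↑ˡ nt ]≔ lookup (fire N t M) q
    q-new : xP z₂ q ≡ lookup (fire N t M) q
    q-new = lookup∘update (q ↑ˡ nt) z₁ _
    done' : ∀ {p} → p ∈ q ∷ l → xP z₂ p ≡ lookup (fire N t M) p
    done' (here refl) = q-new
    done' {p} (there p∈l) with p ≟ q
    ... | yes refl = q-new
    ... | no p≢q   = trans (update-except z₁ (q ↑ˡ nt) _ (p ↑ˡ nt) (p≢q ∘ ↑ˡ-injective nt p q)) (done p∈l)

  finish : ∀ {M t z} → Busy M t z → Settled M t z → Star AS z (βM N (fire N t M))
  finish {M} {t} {z} busy settled = subst (Star AS z) (idle⇒βM idle) (async-set (β N) z (np ↑ʳ t) (settled⇒released busy settled))
    where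
    idle : Idle (fire N t M) (z [ np ↑ʳ t ]≔ false)
    idle = busy→idle busy settled (update-except z (np ↑ʳ t) false) (lookup∘update (np ↑ʳ t) z false)

  fire-simulation : ∀ {M t} → Enabled N t M → Star AS (βM N M) (βM N (fire N t M))
  fire-simulation en with settle (allFin np) (started en)
  ... | _ , settling , busy , done = start en ◅◅ settling ◅◅ finish busy (λ p → done (∈-allFin p))

  simulate : ∀ {M M'} → Star (Step N) M M' → Star AS (βM N M) (βM N M')
  simulate ε = ε
  simulate ((t , en , refl) ◅ run) = fire-simulation en ◅◅ simulate run

  step-from-idle : ∀ {M z z'} → Idle M z → AS z z' → ∃ λ t → Busy M t z'
  step-from-idle {z = z} {z'} idle (i , changed , updated , except) with split np nt i
  ... | left p  = ⊥-elim (changed (sym (trans updated (β-place-quiet z (Idle.quiet idle) p))))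
  ... | right t = t , idle→busy idle (guard⇒enabled t idle guard) except on
    where
    on : xT z' t ≡ true
    on = trans (¬-not (changed ∘ sym)) (cong not (Idle.quiet idle t))
    guard : Guard t z ≡ true
    guard = trans (sym (β-transition-quiet z (Idle.quiet idle) t)) (trans (sym updated) on)

  step-from-busy : ∀ {M t z z'} → Busy M t z → AS z z' → Busy M t z' ⊎ Idle (fire N t M) z'
  step-from-busy busy (i , changed , updated , except) with split np nt i
  ... | left p = inj₁ (busy→busy p busy except (trans updated (β-place-busy busy p)))
  step-from-busy {t = t} {z} {z'} busy (_ , changed , updated , except) | right t' with t' ≟ t
  ... | no t'≢t  = ⊥-elim (changed (trans (Firing.off firing t' t'≢t) (sym (trans updated (β-transition-firing-other firing t'≢t)))))
    where
    firing : Firing t z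
    firing = Busy.firing busy
  ... | yes refl = inj₂ (busy→idle busy (released⇒settled busy (trans (sym updated) off)) except off)
    where
    off : xT z' t ≡ false
    off = trans (¬-not (changed ∘ sym)) (cong not (Firing.on (Busy.firing busy)))

  -- A run between encodings, started in an Idle or Busy configuration, replays
  -- as a firing sequence: every switch-off of a transition is one firing.
  replay : ∀ {z w M M'} → Star AS z w → (Idle M z ⊎ ∃ λ t → Busy M t z) → Idle M' w → Star (Step N) M M'
  replay ε (inj₁ idle) idle' = subst (Star (Step N) _) (idle-unique idle idle') ε
  replay ε (inj₂ (t , busy)) idle' = ⊥-elim (true≢false (trans (sym (Firing.on (Busy.firing busy))) (Idle.quiet idle' t)))
    where
    true≢false : true ≢ false
    true≢false ()
  replay (step ◅ run) (inj₁ idle) idle' = replay run (inj₂ (step-from-idle idle step)) idle'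
  replay (step ◅ run) (inj₂ (t , busy)) idle' with step-from-busy busy step
  ... | inj₁ busy' = replay run (inj₂ (t , busy')) idle'
  ... | inj₂ idle  = (t , Busy.enabled busy , refl) ◅ replay run (inj₁ idle) idle'

theorem2 : (N : RPN) → Safe N → LoopFree N →
    ∀ (M M' : Marking N) →
    Star (Step N) M M' ⇔ Star (AsyncStep (β N)) (βM N M) (βM N M')
theorem2 N _ loop-free M M' = mk⇔ simulate (λ run → replay run (inj₁ (idle-βM M)) (idle-βM M'))
  where open Simulation N loop-free
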